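{- (a) Let $k\in\mathbb{Z}_{\geq0}$ and $\ell\in\mathbb{Z}_{>0}$ with $k\leq\ell$. Every integer $c$ satisfying $\ell\leq c\leq(\ell-k+1)2^k-1$ can be expressed as $\sum_{j=1}^\ell2^{k_j}$ for some $k_1,\dotsc,k_\ell\in\{0,1,\dotsc,k\}$, where $k_j=0$ for some $j\in\{1,2,\dotsc,\ell\}$. (b) Let $k\in\mathbb{Z}_{\geq0}$ and $\ell\in\mathbb{Z}_{>0}$ with $k\leq\ell$. Every odd integer $c$ satisfying $\ell\leq c\leq(\ell-k+2)2^k-3$ can be expressed as $\sum_{j=1}^\ell2^{k_j}$ for some $k_1,\dotsc,k_\ell\in\{0,1,\dotsc,k\}$, where $k_j=0$ for some $j\in\{1,2,\dotsc,\ell\}$. -}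

module Defs where

open import Data.Nat using (ℕ; zero; suc; _+_; _^_)
open import Data.Fin using (Fin; toℕ)
import Data.Fin as F

sumFin : (n : ℕ) → (Fin n → ℕ) → ℕ
sumFin zero    f = 0
sumFin (suc n) f = f F.zero + sumFin n (λ j → f (F.suc j))

powSum : (ℓ k : ℕ) → (Fin ℓ → Fin (suc k)) → ℕ
powSum ℓ k ks = sumFin ℓ (λ j → 2 ^ toℕ (ks j))

{-# OPTIONS --safe #-}
module Submission where

-- Splitting off the summand 1 reduces both parts to: every c with ℓ ≤ c ≤ (ℓ − k + 2)·2^k − 2 is a
-- sum of ℓ powers 2^{k_j} with k_j ≤ k. This goes by induction on k. If c ≤ 2ℓ, use only 1s and 2s.
-- Otherwise c = 2e or c = 2e + 1 with e ≥ ℓ (resp. e ≥ ℓ − 1 after splitting off a 1), and e is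
-- a sum of ℓ (resp. ℓ − 1) powers with exponents at most k − 1: halving the bound loses at most 1,
-- which the extra unit of slack ℓ − k (resp. the sharper bound) pays for. In (b), c − 1 is even
-- and the stronger hypothesis is exactly the bound needed for its half.

open import Defs
open import Data.Nat using (ℕ; zero; suc; _+_; _*_; _∸_; _^_; _≤_; _<_; z≤n; s≤s; _≤?_)
open import Data.Nat.Properties
open import Data.Nat.Divisibility using (_∣_; m∣m*n)
open import Algebra.Properties.CommutativeSemigroup *-commutativeSemigroup using (x∙yz≈y∙xz)
open import Data.Fin using (Fin; toℕ)
import Data.Fin as F
open import Data.Vec.Functional using (_∷_)
open import Data.Product using (_×_; ∃-syntax; _,_)
open import Data.Sum using (inj₁; inj₂)
open import Relation.Nullary using (¬_; yes; no; contradiction)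
open import Relation.Binary.PropositionalEquality

SumOfPowers : ℕ → ℕ → ℕ → Set
SumOfPowers ℓ k c = ∃[ ks ] powSum ℓ k ks ≡ c

*-distribˡ-sumFin : ∀ m n (f : Fin n → ℕ) → m * sumFin n f ≡ sumFin n (λ j → m * f j)
*-distribˡ-sumFin m zero    f = *-zeroʳ m
*-distribˡ-sumFin m (suc n) f = begin
  m * (f F.zero + sumFin n (λ j → f (F.suc j)))       ≡⟨ *-distribˡ-+ m (f F.zero) _ ⟩
  m * f F.zero + m * sumFin n (λ j → f (F.suc j))     ≡⟨ cong (m * f F.zero +_) (*-distribˡ-sumFin m n _) ⟩
  m * f F.zero + sumFin n (λ j → m * f (F.suc j))     ∎
  where open ≡-Reasoning

sumOfPowers-cons : ∀ {ℓ k c} (i : Fin (suc k)) → SumOfPowers ℓ k c → SumOfPowers (suc ℓ) k (2 ^ toℕ i + c)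
sumOfPowers-cons i (ks , sum≡c) = (i ∷ ks) , cong (2 ^ toℕ i +_) sum≡c

sumOfPowers-double : ∀ {ℓ k c} → SumOfPowers ℓ k c → SumOfPowers ℓ (suc k) (2 * c)
sumOfPowers-double {ℓ} (ks , sum≡c) =
  (λ j → F.suc (ks j)) , trans (sym (*-distribˡ-sumFin 2 ℓ _)) (cong (2 *_) sum≡c)

sumOfPowers-ones : ∀ ℓ k → SumOfPowers ℓ k ℓ
sumOfPowers-ones zero    k = (λ ()) , refl
sumOfPowers-ones (suc ℓ) k = sumOfPowers-cons F.zero (sumOfPowers-ones ℓ k)

sumOfPowers-between : ∀ k {ℓ c} → ℓ ≤ c → c ≤ 2 * ℓ → SumOfPowers ℓ (suc k) c
sumOfPowers-between k {zero} z≤n z≤n = sumOfPowers-ones 0 (suc k)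
sumOfPowers-between k {suc ℓ} {suc c} (s≤s ℓ≤c) c<2ℓ+2 with m≤n⇒m<n∨m≡n ℓ≤c
... | inj₂ refl = sumOfPowers-ones (suc ℓ) (suc k)
... | inj₁ (s≤s {n = c′} ℓ≤c′) = sumOfPowers-cons (F.suc F.zero) (sumOfPowers-between k ℓ≤c′ c′≤2ℓ)
  where
  c′≤2ℓ : c′ ≤ 2 * ℓ
  c′≤2ℓ = ≤-pred (≤-pred (subst (suc c ≤_) (*-suc 2 ℓ) c<2ℓ+2))

data EvenOdd : ℕ → Set where
  even : ∀ e → EvenOdd (2 * e)
  odd  : ∀ e → EvenOdd (1 + 2 * e)

evenOdd : ∀ n → EvenOdd n
evenOdd zero = even 0
evenOdd (suc n) with evenOdd n
... | even e = odd e
... | odd e  = subst EvenOdd (*-suc 2 e) (even (suc e))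

*-2^-suc : ∀ m k → m * 2 ^ suc k ≡ 2 * (m * 2 ^ k)
*-2^-suc m k = x∙yz≈y∙xz m 2 (2 ^ k)

-- n = ℓ + 1 − k is the slack, so the bound reads c ≤ (ℓ − k + 2)·2^k − 2.
sumOfPowers-interval : ∀ k n {ℓ c} → suc ℓ ≡ k + n → ℓ ≤ c → 2 + c ≤ suc n * 2 ^ k →
                       SumOfPowers ℓ k c
sumOfPowers-interval zero .(suc ℓ) {ℓ} {c} refl ℓ≤c 2+c≤ℓ+2 =
  subst (SumOfPowers ℓ 0) (≤-antisym ℓ≤c c≤ℓ) (sumOfPowers-ones ℓ 0)
  where
  c≤ℓ : c ≤ ℓ
  c≤ℓ = ≤-pred (≤-pred (subst (2 + c ≤_) (*-identityʳ (2 + ℓ)) 2+c≤ℓ+2))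
sumOfPowers-interval (suc k) n {ℓ} {c} eq ℓ≤c bound with c ≤? 2 * ℓ | evenOdd c
... | yes c≤2ℓ | _ = sumOfPowers-between k ℓ≤c c≤2ℓ
... | no c≰2ℓ | even e =
  sumOfPowers-double (sumOfPowers-interval k (suc n) (trans eq (sym (+-suc k n))) ℓ≤e 2+e≤)
  where
  ℓ≤e : ℓ ≤ e
  ℓ≤e = <⇒≤ (*-cancelˡ-< 2 ℓ e (≰⇒> c≰2ℓ))
  1+e≤ : 1 + e ≤ suc n * 2 ^ k
  1+e≤ = *-cancelˡ-≤ 2 (subst₂ _≤_ (sym (*-suc 2 e)) (*-2^-suc (suc n) k) bound)
  2+e≤ : 2 + e ≤ suc (suc n) * 2 ^ k
  2+e≤ = +-mono-≤ (m^n>0 2 k) 1+e≤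
-- ℓ = 0 forces k = 1 and n = 0, hence c = 0.
sumOfPowers-interval (suc zero) zero {zero} refl _ (s≤s (s≤s ())) | no _ | odd e
sumOfPowers-interval (suc k) n {suc ℓ} eq ℓ≤c bound | no c≰2ℓ | odd e =
  sumOfPowers-cons F.zero (sumOfPowers-double (sumOfPowers-interval k n (suc-injective eq) ℓ≤e 2+e≤))
  where
  ℓ≤e : ℓ ≤ e
  ℓ≤e = <⇒≤ (*-cancelˡ-≤ 2 (≤-pred (≰⇒> c≰2ℓ)))
  2+e≤ : 2 + e ≤ suc n * 2 ^ k
  2+e≤ = *-cancelˡ-< 2 (1 + e) _ (subst₂ _≤_ (cong suc (sym (*-suc 2 e))) (*-2^-suc (suc n) k) bound)

sumOfPowers-withOne : ∀ {ℓ k c} → SumOfPowers ℓ k c →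
                      ∃[ ks ] (powSum (suc ℓ) k ks ≡ suc c × ∃[ j ] toℕ (ks j) ≡ 0)
sumOfPowers-withOne (ks , sum≡c) = (F.zero ∷ ks) , cong suc sum≡c , F.zero , refl

lemma2p3-a : (k ℓ : ℕ) → 0 < ℓ → k ≤ ℓ → (c : ℕ) → ℓ ≤ c → c + 1 ≤ (ℓ ∸ k + 1) * 2 ^ k →
             ∃[ ks ] (powSum ℓ k ks ≡ c × ∃[ j ] toℕ (ks j) ≡ 0)
lemma2p3-a k (suc ℓ) _ k≤ℓ+1 (suc c) (s≤s ℓ≤c) bound =
  sumOfPowers-withOne (sumOfPowers-interval k (suc ℓ ∸ k) (sym (m+[n∸m]≡n k≤ℓ+1)) ℓ≤c 2+c≤)
  where
  2+c≤ : 2 + c ≤ suc (suc ℓ ∸ k) * 2 ^ k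
  2+c≤ = subst₂ _≤_ (+-comm (suc c) 1) (cong (_* 2 ^ k) (+-comm (suc ℓ ∸ k) 1)) bound

lemma2p3-b : (k ℓ : ℕ) → 0 < ℓ → k ≤ ℓ → (c : ℕ) → ¬ (2 ∣ c) → ℓ ≤ c → c + 3 ≤ (ℓ ∸ k + 2) * 2 ^ k →
             ∃[ ks ] (powSum ℓ k ks ≡ c × ∃[ j ] toℕ (ks j) ≡ 0)
lemma2p3-b zero ℓ _ _ c _ ℓ≤c bound = contradiction c+3≤c+2 (<⇒≱ (+-monoʳ-< c (n<1+n 2)))
  where
  c+3≤c+2 : c + 3 ≤ c + 2
  c+3≤c+2 = ≤-trans bound (≤-trans (≤-reflexive (*-identityʳ (ℓ + 2))) (+-monoˡ-≤ 2 ℓ≤c))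
lemma2p3-b (suc k) (suc ℓ) _ (s≤s k≤ℓ) (suc c) c-odd (s≤s ℓ≤c) bound with evenOdd c
... | odd e = contradiction (subst (2 ∣_) (*-suc 2 e) (m∣m*n (suc e))) c-odd
... | even e with 2 * e ≤? 2 * ℓ
...   | yes 2e≤2ℓ = sumOfPowers-withOne (sumOfPowers-between k ℓ≤c 2e≤2ℓ)
...   | no 2e≰2ℓ = sumOfPowers-withOne (sumOfPowers-double (sumOfPowers-interval k (suc ℓ ∸ k) eq ℓ≤e 2+e≤))
  where
  eq : suc ℓ ≡ k + (suc ℓ ∸ k)
  eq = sym (m+[n∸m]≡n (m≤n⇒m≤1+n k≤ℓ))
  ℓ≤e : ℓ ≤ e
  ℓ≤e = <⇒≤ (*-cancelˡ-< 2 ℓ e (≰⇒> 2e≰2ℓ))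
  2+e≤ : 2 + e ≤ suc (suc ℓ ∸ k) * 2 ^ k
  2+e≤ = *-cancelˡ-≤ 2 (begin
    2 * (2 + e)                     ≡⟨ *-distribˡ-+ 2 2 e ⟩
    3 + suc (2 * e)                 ≡⟨ +-comm 3 (suc (2 * e)) ⟩
    suc (2 * e) + 3                 ≤⟨ bound ⟩
    (ℓ ∸ k + 2) * 2 ^ suc k         ≡⟨ *-2^-suc (ℓ ∸ k + 2) k ⟩
    2 * ((ℓ ∸ k + 2) * 2 ^ k)       ≡⟨ cong (λ m → 2 * (m * 2 ^ k)) (+-comm (ℓ ∸ k) 2) ⟩
    2 * (suc (suc (ℓ ∸ k)) * 2 ^ k) ≡⟨ cong (λ m → 2 * (suc m * 2 ^ k)) (+-∸-assoc 1 k≤ℓ) ⟨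
    2 * (suc (suc ℓ ∸ k) * 2 ^ k)   ∎)
    where open ≤-Reasoning

lemma2p3 : ((k ℓ : ℕ) → 0 < ℓ → k ≤ ℓ → (c : ℕ) → ℓ ≤ c → c + 1 ≤ (ℓ ∸ k + 1) * 2 ^ k →
               ∃[ ks ] (powSum ℓ k ks ≡ c × ∃[ j ] toℕ (ks j) ≡ 0))
             × ((k ℓ : ℕ) → 0 < ℓ → k ≤ ℓ → (c : ℕ) → ¬ (2 ∣ c) → ℓ ≤ c → c + 3 ≤ (ℓ ∸ k + 2) * 2 ^ k →
               ∃[ ks ] (powSum ℓ k ks ≡ c × ∃[ j ] toℕ (ks j) ≡ 0))
lemma2p3 = lemma2p3-a , lemma2p3-b
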